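{- Let $k\geq 3$ and $n=2k+1$. Let $\sigma:[n]\to[n]$ be the circular shift $\sigma(i)=i+1$ for $1\le i\le n-1$ and $\sigma(n)=1$, and for $A\subset[n]$ write $\sigma(A)=\{\sigma(a):a\in A\}$. Let $L_3=\{1,2,4\}$ and, for $k\geq 4$, $L_k=\{1,2,4\}\cup\{7,9,11,\ldots,2k-1\}$. Let $\mathcal{F}_k=\{\sigma^i(L_k): i=0,1,\ldots,n-1\}$, let $\mathcal{Q}_k=\{A\subset[n]: |A|\geq k+1\}$, let $\bar{\mathcal{F}}_k=\{[n]\setminus A: A\in\mathcal{F}_k\}$, and let $$\mathcal{P}_k=\mathcal{F}_k\cup(\mathcal{Q}_k\setminus\bar{\mathcal{F}}_k).$$ Then $\mathcal{P}_k$ is a regular intersecting family and $\mathrm{div}(\mathcal{P}_k)=\mathrm{div}(\mathcal{Q}_k)+1$, where $\mathrm{div}(\mathcal{Q}_k)=\sum_{i=k+1}^{2k}\binom{2k}{i}$.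
   Context: $[n]=\{1,\ldots,n\}$ and $2^{[n]}$ is the family of all subsets of $[n]$. A family $\mathcal{F}\subset 2^{[n]}$ is intersecting if any two of its members have nonempty intersection. The degree of $x\in[n]$ in $\mathcal{F}$ is the number of members of $\mathcal{F}$ containing $x$; $\mathcal{F}$ is regular if all $x\in[n]$ have the same degree. For an intersecting family $\mathcal{F}$, its diversity is $\mathrm{div}(\mathcal{F})=|\mathcal{F}|-\max_{x\in[n]}|\mathcal{F}(x)|$, where $\mathcal{F}(x)=\{F\in\mathcal{F}: x\in F\}$. -}

module Defs where

open import Data.Bool using (Bool; true; false; not; _∧_; _∨_; T)
open import Data.Nat using (ℕ; zero; suc; _+_; _*_; _∸_; _≤_; _⊔_; _%_)
open import Data.Nat.Properties using (_≤?_)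
import Data.Nat as ℕ
open import Data.Nat.DivMod using (_mod_)
open import Data.Nat.Combinatorics using (_C_)
open import Data.Nat.ListAction using (sum)
open import Data.Fin using (Fin; toℕ)
open import Data.Fin.Properties using (any?)
open import Data.Fin.Subset using (Subset; inside; outside; _∈_; _∩_; ∁; ∣_∣; Nonempty)
open import Data.Fin.Subset.Properties using (_∈?_)
open import Data.Vec using (Vec; []; _∷_; tabulate)
open import Data.Vec.Properties using (≡-dec)
import Data.Bool.Properties as BoolP
open import Data.List using (List; []; _∷_; _++_; map; length; filterᵇ; foldr; upTo)
open import Data.Fin using (_≟_)
open import Data.List using (allFin)
open import Relation.Nullary using (Dec; does; _×-dec_; _⊎-dec_)
open import Relation.Binary.PropositionalEquality using (_≡_)

-- Ground set [n] is modelled by Fin n; the element i ∈ [n] (1-based)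
-- corresponds to the index i - 1 : Fin n.

Family : ℕ → Set
Family n = Subset n → Bool

allSubsets : (n : ℕ) → List (Subset n)
allSubsets zero = [] ∷ []
allSubsets (suc n) = map (outside ∷_) (allSubsets n) ++ map (inside ∷_) (allSubsets n)

size : ∀ {n} → Family n → ℕ
size {n} F = length (filterᵇ F (allSubsets n))

degree : ∀ {n} → Family n → Fin n → ℕ
degree {n} F x = length (filterᵇ (λ A → F A ∧ does (x ∈? A)) (allSubsets n))

-- max_x |F(x)|  (0 if n = 0)
maxDegree : ∀ {n} → Family n → ℕ
maxDegree {n} F = foldr _⊔_ 0 (map (degree F) (allFin n))

diversity : ∀ {n} → Family n → ℕ
diversity F = size F ∸ maxDegree F

Intersecting : ∀ {n} → Family n → Set
Intersecting {n} F = (A B : Subset n) → T (F A) → T (F B) → Nonempty (A ∩ B)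

Regular : ∀ {n} → Family n → Set
Regular {n} F = (x y : Fin n) → degree F x ≡ degree F y

N : ℕ → ℕ
N k = suc (2 * k)

-- circular shift σ(i) = i+1 (mod n); on 0-based indices j ↦ (j+1) mod n
σ : ∀ {m} → Fin (suc m) → Fin (suc m)
σ {m} j = suc (toℕ j) mod (suc m)

σImg : ∀ {m} → Subset (suc m) → Subset (suc m)
σImg A = tabulate (λ j → does (any? (λ a → (a ∈? A) ×-dec (σ a ≟ j))))

σPow : ∀ {m} → ℕ → Subset (suc m) → Subset (suc m)
σPow zero A = A
σPow (suc i) A = σImg (σPow i A)

-- membership of the (1-based) element v in L_k:
-- L_k = {1,2,4} ∪ {7,9,11,...,2k-1}  (the second part empty when k = 3)
inL : ℕ → ℕ → Bool
inL k v = does ((v ℕ.≟ 1) ⊎-dec (v ℕ.≟ 2) ⊎-dec (v ℕ.≟ 4)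
               ⊎-dec ((v % 2 ℕ.≟ 1) ×-dec (7 ≤? v) ×-dec (v ≤? 2 * k ∸ 1)))

L : (k : ℕ) → Subset (N k)
L k = tabulate (λ j → inL k (suc (toℕ j)))

_≟ₛ_ : ∀ {n} (A B : Subset n) → Dec (A ≡ B)
_≟ₛ_ = ≡-dec BoolP._≟_

𝓕 : (k : ℕ) → Family (N k)
𝓕 k A = does (any? (λ (i : Fin (N k)) → A ≟ₛ σPow (toℕ i) (L k)))

𝓠 : (k : ℕ) → Family (N k)
𝓠 k A = does (suc k ≤? ∣ A ∣)

𝓕̄ : (k : ℕ) → Family (N k)
𝓕̄ k B = does (any? (λ (i : Fin (N k)) → B ≟ₛ ∁ (σPow (toℕ i) (L k))))

𝓟 : (k : ℕ) → Family (N k)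
𝓟 k A = 𝓕 k A ∨ (𝓠 k A ∧ not (𝓕̄ k A))

binomSum : ℕ → ℕ
binomSum k = sum (map (λ j → (2 * k) C (suc k + j)) (upTo k))

module Submission where

-- P_k arises from Q_k by deleting the n complements of the shifts of L_k (sets of size k+1) and
-- adding the n shifts themselves (sets of size k), so |P_k| = |Q_k|.  By rotation invariance
-- every point lies in k shifts and in k+1 complements, hence P_k is regular with degree one less
-- than the regular family Q_k, and div(P_k) = div(Q_k) + 1.  For intersection: two sets of size
-- at least k+1 in [2k+1] meet; a shift disjoint from a set B of size at least k+1 forces B to be
-- the complement of that shift, which was deleted; and two shifts of L_k meet because every
-- residue modulo 2k+1 is a difference of two elements of L_k.

open import Defs
open import Data.Bool using (Bool; true; false; not; _∧_; _∨_; T)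
open import Data.Bool.Properties using (∧-zeroʳ; ∧-identityʳ; not-injective; not-¬; T-≡; T-∨; T-∧; T-not-≡)
open import Data.Nat using (ℕ; zero; suc; _+_; _*_; _∸_; _≤_; _<_; z≤n; s≤s; s≤s⁻¹; _%_; _⊔_; NonZero)
import Data.Nat as ℕ
open import Data.Nat.Properties hiding (_≟_)
open import Data.Nat.DivMod
open import Data.Nat.Combinatorics using (_C_; nCk+nC[k+1]≡[n+1]C[k+1])
open import Data.Nat.ListAction using (sum)
open import Data.List using (List; []; _∷_; _++_; map; length; filterᵇ; foldr; applyUpTo; allFin)
open import Data.List.Properties using (map-applyUpTo)
open import Data.Fin using (Fin; toℕ; zero; suc)
open import Data.Fin.Properties using (toℕ-fromℕ<; toℕ-injective; toℕ<n; any?)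
open import Data.Fin.Subset using (Subset; inside; outside; ∣_∣; _∈_; _∩_; ∁; _⊆_)
open import Data.Fin.Subset.Properties
  using (_∈?_; drop-∷-⊆; p⊆q⇒∣p∣≤∣q∣; nonempty?; x∈p∩q⁺; x∉p⇒x∈∁p; ∣∁p∣≡n∸∣p∣; ∣p∣≤n)
open import Data.Vec using ([]; _∷_; lookup; here)
open import Data.Vec.Properties using (lookup∘tabulate; lookup⇒[]=; ∷-injectiveˡ; ∷-injectiveʳ; lookup-map)
open import Data.Product using (Σ; _,_; _×_)
open import Data.Sum using (_⊎_; inj₁; inj₂)
open import Data.Empty using (⊥; ⊥-elim)
open import Function using (_∘_)
open import Function.Bundles using (Equivalence)
open import Relation.Nullary using (Dec; yes; no; does; ¬_; _×-dec_; _⊎-dec_)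
open import Relation.Nullary.Decidable using (dec-true; dec-false; does-≡; map′)
open import Relation.Binary.PropositionalEquality
open import Relation.Binary.Definitions using (tri<; tri≈; tri>)
open import Algebra.Properties.CommutativeSemigroup +-commutativeSemigroup using () renaming (interchange to +-interchange)

does-⇔ : ∀ {P Q : Set} (p : Dec P) (q : Dec Q) → (P → Q) → (Q → P) → does p ≡ does q
does-⇔ p q f g = does-≡ (map′ f g p) q

does≡true⇒ : ∀ {P : Set} (p : Dec P) → does p ≡ true → P
does≡true⇒ (yes x) _ = x

𝟙 : Bool → ℕ
𝟙 true = 1
𝟙 false = 0

-- Finite sums

sumBy : ∀ {X : Set} → (X → ℕ) → List X → ℕ
sumBy w [] = 0
sumBy w (x ∷ xs) = w x + sumBy w xs

length-filterᵇ : ∀ {X : Set} (p : X → Bool) xs → length (filterᵇ p xs) ≡ sumBy (𝟙 ∘ p) xs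
length-filterᵇ p [] = refl
length-filterᵇ p (x ∷ xs) with p x
... | true = cong suc (length-filterᵇ p xs)
... | false = length-filterᵇ p xs

sumBy-++ : ∀ {X : Set} (w : X → ℕ) xs ys → sumBy w (xs ++ ys) ≡ sumBy w xs + sumBy w ys
sumBy-++ w [] ys = refl
sumBy-++ w (x ∷ xs) ys = trans (cong (w x +_) (sumBy-++ w xs ys)) (sym (+-assoc (w x) _ _))

sumBy-map : ∀ {X Y : Set} (w : Y → ℕ) (f : X → Y) xs → sumBy w (map f xs) ≡ sumBy (w ∘ f) xs
sumBy-map w f [] = refl
sumBy-map w f (x ∷ xs) = cong (w (f x) +_) (sumBy-map w f xs)

sumBy-cong : ∀ {X : Set} {v w : X → ℕ} → (∀ x → v x ≡ w x) → ∀ xs → sumBy v xs ≡ sumBy w xs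
sumBy-cong e [] = refl
sumBy-cong e (x ∷ xs) = cong₂ _+_ (e x) (sumBy-cong e xs)

sumBy-+ : ∀ {X : Set} (v w : X → ℕ) xs → sumBy (λ x → v x + w x) xs ≡ sumBy v xs + sumBy w xs
sumBy-+ v w [] = refl
sumBy-+ v w (x ∷ xs) =
  trans (cong (v x + w x +_) (sumBy-+ v w xs)) (+-interchange (v x) (w x) (sumBy v xs) (sumBy w xs))

∑< : ℕ → (ℕ → ℕ) → ℕ
∑< r f = sum (applyUpTo f r)

∑<-cong : ∀ r {f g : ℕ → ℕ} → (∀ j → j < r → f j ≡ g j) → ∑< r f ≡ ∑< r g
∑<-cong zero e = refl
∑<-cong (suc r) e = cong₂ _+_ (e 0 (s≤s z≤n)) (∑<-cong r (λ j j<r → e (suc j) (s≤s j<r)))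

∑<-suc : ∀ r f → ∑< (suc r) f ≡ ∑< r f + f r
∑<-suc zero f = +-comm (f 0) 0
∑<-suc (suc r) f = trans (cong (f 0 +_) (∑<-suc r (f ∘ suc))) (sym (+-assoc (f 0) _ _))

∑<-reverse : ∀ r f → ∑< r (λ j → f (r ∸ suc j)) ≡ ∑< r f
∑<-reverse zero f = refl
∑<-reverse (suc r) f = trans (cong (f r +_) (∑<-reverse r f)) (trans (+-comm (f r) _) (sym (∑<-suc r f)))

∑<-shift : ∀ r (h : ℕ → ℕ) → h r ≡ h 0 → ∑< r (h ∘ suc) ≡ ∑< r h
∑<-shift zero h p = refl
∑<-shift (suc r) h p = begin
  ∑< (suc r) (h ∘ suc)     ≡⟨ ∑<-suc r (h ∘ suc) ⟩
  ∑< r (h ∘ suc) + h (suc r) ≡⟨ cong (∑< r (h ∘ suc) +_) p ⟩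
  ∑< r (h ∘ suc) + h 0      ≡⟨ +-comm _ (h 0) ⟩
  ∑< (suc r) h             ∎
  where open ≡-Reasoning

∑<-periodic : ∀ r (h : ℕ → ℕ) → (∀ j → h (j + r) ≡ h j) → ∀ c → ∑< r (λ j → h (c + j)) ≡ ∑< r h
∑<-periodic r h per zero = refl
∑<-periodic r h per (suc c) = begin
  ∑< r (λ j → h (suc c + j))   ≡⟨ ∑<-cong r (λ j _ → cong h (sym (+-suc c j))) ⟩
  ∑< r (λ j → h (c + suc j))   ≡⟨ ∑<-shift r (λ j → h (c + j)) (trans (per c) (cong h (sym (+-identityʳ c)))) ⟩
  ∑< r (λ j → h (c + j))       ≡⟨ ∑<-periodic r h per c ⟩
  ∑< r h                       ∎
  where open ≡-Reasoning

sumBy-∑< : ∀ {X : Set} r (w : ℕ → X → ℕ) xs → sumBy (λ x → ∑< r (λ j → w j x)) xs ≡ ∑< r (λ j → sumBy (w j) xs)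
sumBy-∑< zero w [] = refl
sumBy-∑< zero w (x ∷ xs) = sumBy-∑< zero w xs
sumBy-∑< (suc r) w xs =
  trans (sumBy-+ (w 0) _ xs) (cong (sumBy (w 0) xs +_) (sumBy-∑< r (w ∘ suc) xs))

countFin : ∀ n → (Fin n → Bool) → ℕ
countFin zero f = 0
countFin (suc n) f = 𝟙 (f zero) + countFin n (f ∘ suc)

countFin-cong : ∀ n {f g : Fin n → Bool} → (∀ i → f i ≡ g i) → countFin n f ≡ countFin n g
countFin-cong zero e = refl
countFin-cong (suc n) e = cong₂ _+_ (cong 𝟙 (e zero)) (countFin-cong n (e ∘ suc))

countFin-∑< : ∀ n (f : Fin n → Bool) (g : ℕ → ℕ) → (∀ i → 𝟙 (f i) ≡ g (toℕ i)) → countFin n f ≡ ∑< n g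
countFin-∑< zero f g e = refl
countFin-∑< (suc n) f g e = cong₂ _+_ (e zero) (countFin-∑< n (f ∘ suc) (g ∘ suc) (e ∘ suc))

countFin-const : ∀ n → countFin n (λ _ → true) ≡ n
countFin-const zero = refl
countFin-const (suc n) = cong suc (countFin-const n)

countFin-not : ∀ n f → countFin n (not ∘ f) + countFin n f ≡ n
countFin-not zero f = refl
countFin-not (suc n) f with f zero
... | true = trans (+-suc (countFin n _) _) (cong suc (countFin-not n _))
... | false = cong suc (countFin-not n _)

∣p∣≡countFin : ∀ {n} (p : Subset n) → ∣ p ∣ ≡ countFin n (lookup p)
∣p∣≡countFin [] = refl
∣p∣≡countFin (true ∷ p) = cong suc (∣p∣≡countFin p)
∣p∣≡countFin (false ∷ p) = ∣p∣≡countFin p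

-- Subsets and families

∁-injective : ∀ {n} {p q : Subset n} → ∁ p ≡ ∁ q → p ≡ q
∁-injective {p = []} {[]} _ = refl
∁-injective {p = x ∷ p} {y ∷ q} e = cong₂ _∷_ (not-injective (∷-injectiveˡ e)) (∁-injective (∷-injectiveʳ e))

Disjoint : ∀ {n} → Subset n → Subset n → Set
Disjoint A B = ∀ {x} → x ∈ A → x ∈ B → ⊥

disjoint⇒⊆∁ : ∀ {n} {A B : Subset n} → Disjoint A B → B ⊆ ∁ A
disjoint⇒⊆∁ disjoint x∈B = x∉p⇒x∈∁p (λ x∈A → disjoint x∈A x∈B)

⊆∧∣q∣≤∣p∣⇒p≡q : ∀ {n} (p q : Subset n) → p ⊆ q → ∣ q ∣ ≤ ∣ p ∣ → p ≡ q
⊆∧∣q∣≤∣p∣⇒p≡q [] [] _ _ = refl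
⊆∧∣q∣≤∣p∣⇒p≡q (false ∷ p) (false ∷ q) p⊆q ∣q∣≤∣p∣ = cong (false ∷_) (⊆∧∣q∣≤∣p∣⇒p≡q p q (drop-∷-⊆ p⊆q) ∣q∣≤∣p∣)
⊆∧∣q∣≤∣p∣⇒p≡q (true ∷ p) (true ∷ q) p⊆q (s≤s ∣q∣≤∣p∣) = cong (true ∷_) (⊆∧∣q∣≤∣p∣⇒p≡q p q (drop-∷-⊆ p⊆q) ∣q∣≤∣p∣)
⊆∧∣q∣≤∣p∣⇒p≡q (true ∷ p) (false ∷ q) p⊆q _ with () ← p⊆q here
⊆∧∣q∣≤∣p∣⇒p≡q (false ∷ p) (true ∷ q) p⊆q ∣q∣≤∣p∣ = ⊥-elim (<⇒≱ (s≤s (p⊆q⇒∣p∣≤∣q∣ (drop-∷-⊆ p⊆q))) ∣q∣≤∣p∣)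

∑ₛ : ∀ n → (Subset n → ℕ) → ℕ
∑ₛ n w = sumBy w (allSubsets n)

∑ₛ-suc : ∀ n (w : Subset (suc n) → ℕ) → ∑ₛ (suc n) w ≡ ∑ₛ n (λ A → w (outside ∷ A)) + ∑ₛ n (λ A → w (inside ∷ A))
∑ₛ-suc n w = trans (sumBy-++ w (map (outside ∷_) (allSubsets n)) _)
  (cong₂ _+_ (sumBy-map w _ (allSubsets n)) (sumBy-map w _ (allSubsets n)))

∑ₛ-cong : ∀ n {v w : Subset n → ℕ} → (∀ A → v A ≡ w A) → ∑ₛ n v ≡ ∑ₛ n w
∑ₛ-cong n e = sumBy-cong e (allSubsets n)

∑ₛ-+ : ∀ n (v w : Subset n → ℕ) → ∑ₛ n (λ A → v A + w A) ≡ ∑ₛ n v + ∑ₛ n w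
∑ₛ-+ n v w = sumBy-+ v w (allSubsets n)

∑ₛ-zero : ∀ n → ∑ₛ n (λ _ → 0) ≡ 0
∑ₛ-zero zero = refl
∑ₛ-zero (suc n) = trans (∑ₛ-suc n (λ _ → 0)) (cong₂ _+_ (∑ₛ-zero n) (∑ₛ-zero n))

∑ₛ-≟ : ∀ n (B : Subset n) → ∑ₛ n (λ A → 𝟙 (does (A ≟ₛ B))) ≡ 1
∑ₛ-≟ zero [] = refl
∑ₛ-≟ (suc n) (true ∷ B) = trans (∑ₛ-suc n _) (cong₂ _+_ (∑ₛ-zero n) (∑ₛ-≟ n B))
∑ₛ-≟ (suc n) (false ∷ B) = trans (∑ₛ-suc n _) (cong₂ _+_ (∑ₛ-≟ n B) (∑ₛ-zero n))

sizeWhere : ∀ {n} → Family n → (Subset n → Bool) → ℕ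
sizeWhere {n} F m = ∑ₛ n (λ A → 𝟙 (F A ∧ m A))

size≡sizeWhere : ∀ {n} (F : Family n) → size F ≡ sizeWhere F (λ _ → true)
size≡sizeWhere {n} F = trans (length-filterᵇ F (allSubsets n)) (∑ₛ-cong n (λ A → cong 𝟙 (sym (∧-identityʳ (F A)))))

∈?≡lookup : ∀ {n} (x : Fin n) (A : Subset n) → does (x ∈? A) ≡ lookup A x
∈?≡lookup zero (true ∷ A) = refl
∈?≡lookup zero (false ∷ A) = refl
∈?≡lookup (suc x) (b ∷ A) with x ∈? A | ∈?≡lookup x A
... | yes _ | e = e
... | no _ | e = e

degree≡sizeWhere : ∀ {n} (F : Family n) x → degree F x ≡ sizeWhere F (λ A → lookup A x)
degree≡sizeWhere {n} F x = trans (length-filterᵇ _ (allSubsets n)) (∑ₛ-cong n (λ A → cong (λ b → 𝟙 (F A ∧ b)) (∈?≡lookup x A)))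

enumerated : ∀ {n r} → (Fin r → Subset n) → Family n
enumerated g A = does (any? (λ i → A ≟ₛ g i))

sizeWhere-enumerated : ∀ {n} r (g : Fin r → Subset n) → (∀ i j → g i ≡ g j → i ≡ j) →
  ∀ m → sizeWhere (enumerated g) m ≡ countFin r (m ∘ g)
sizeWhere-enumerated {n} zero g g-inj m = ∑ₛ-zero n
sizeWhere-enumerated {n} (suc r) g g-inj m = begin
  sizeWhere (enumerated g) m
    ≡⟨ ∑ₛ-cong n split ⟩
  ∑ₛ n (λ A → 𝟙 (does (A ≟ₛ g zero) ∧ m (g zero)) + 𝟙 (enumerated (g ∘ suc) A ∧ m A))
    ≡⟨ ∑ₛ-+ n _ _ ⟩
  ∑ₛ n (λ A → 𝟙 (does (A ≟ₛ g zero) ∧ m (g zero))) + sizeWhere (enumerated (g ∘ suc)) m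
    ≡⟨ cong₂ _+_ (first (m (g zero))) (sizeWhere-enumerated r (g ∘ suc) tail-inj m) ⟩
  𝟙 (m (g zero)) + countFin r (m ∘ g ∘ suc) ∎
  where
  open ≡-Reasoning
  tail-inj : ∀ i j → g (suc i) ≡ g (suc j) → i ≡ j
  tail-inj i j e = Data.Fin.Properties.suc-injective (g-inj (suc i) (suc j) e)
  first : ∀ b → ∑ₛ n (λ A → 𝟙 (does (A ≟ₛ g zero) ∧ b)) ≡ 𝟙 b
  first true = trans (∑ₛ-cong n (λ A → cong 𝟙 (∧-identityʳ _))) (∑ₛ-≟ n (g zero))
  first false = trans (∑ₛ-cong n (λ A → cong 𝟙 (∧-zeroʳ _))) (∑ₛ-zero n)
  split : ∀ A → 𝟙 (enumerated g A ∧ m A)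
              ≡ 𝟙 (does (A ≟ₛ g zero) ∧ m (g zero)) + 𝟙 (enumerated (g ∘ suc) A ∧ m A)
  split A with A ≟ₛ g zero
  ... | no _ = refl
  ... | yes refl with any? (λ i → g zero ≟ₛ g (suc i))
  ...   | yes (i , e) with () ← g-inj zero (suc i) e
  ...   | no _ with m (g zero)
  ...     | true = refl
  ...     | false = refl

size-enumerated : ∀ {n} r (g : Fin r → Subset n) → (∀ i j → g i ≡ g j → i ≡ j) → size (enumerated g) ≡ r
size-enumerated r g g-inj = trans (size≡sizeWhere (enumerated g))
  (trans (sizeWhere-enumerated r g g-inj (λ _ → true)) (countFin-const r))

maxDegree-regular : ∀ {m} (F : Family (suc m)) d → (∀ x → degree F x ≡ d) → maxDegree F ≡ d
maxDegree-regular F d deg = ≤-antisym (foldr-⊔-≤ (allFin _)) (≤-trans (≤-reflexive (sym (deg zero))) (m≤m⊔n _ _))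
  where
  foldr-⊔-≤ : ∀ xs → foldr _⊔_ 0 (map (degree F) xs) ≤ d
  foldr-⊔-≤ [] = z≤n
  foldr-⊔-≤ (x ∷ xs) = ⊔-lub (≤-reflexive (deg x)) (foldr-⊔-≤ xs)

diversity-regular : ∀ {m} (F : Family (suc m)) d → (∀ x → degree F x ≡ d) → diversity F ≡ size F ∸ d
diversity-regular F d deg = cong (size F ∸_) (maxDegree-regular F d deg)

-- Counting subsets by size

atLeast : ℕ → ℕ → ℕ
atLeast n t = ∑ₛ n (λ A → 𝟙 (does (t ≤? ∣ A ∣)))

exactly : ℕ → ℕ → ℕ
exactly n s = ∑ₛ n (λ A → 𝟙 (does (∣ A ∣ ℕ.≟ s)))

does-≤?-suc : ∀ t a → does (t ≤? suc a) ≡ does (t ∸ 1 ≤? a)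
does-≤?-suc t a = does-⇔ (t ≤? suc a) (t ∸ 1 ≤? a) to from
  where
  to : t ≤ suc a → t ∸ 1 ≤ a
  to = ∸-monoˡ-≤ 1
  from : t ∸ 1 ≤ a → t ≤ suc a
  from t∸1≤a = ≤-trans (m≤n+m∸n t 1) (s≤s t∸1≤a)

atLeast-suc : ∀ n t → atLeast (suc n) t ≡ atLeast n t + atLeast n (t ∸ 1)
atLeast-suc n t = trans (∑ₛ-suc n _) (cong (atLeast n t +_) (∑ₛ-cong n (λ A → cong 𝟙 (does-≤?-suc t ∣ A ∣))))

sizeAtLeast : ∀ {n} → ℕ → Family n
sizeAtLeast t A = does (t ≤? ∣ A ∣)

atLeast-containing : ∀ n t (x : Fin (suc n)) → sizeWhere (sizeAtLeast t) (λ A → lookup A x) ≡ atLeast n (t ∸ 1)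
atLeast-containing n t zero = trans (∑ₛ-suc n _) (cong₂ _+_
  (trans (∑ₛ-cong n (λ A → cong 𝟙 (∧-zeroʳ _))) (∑ₛ-zero n))
  (∑ₛ-cong n (λ A → cong 𝟙 (trans (∧-identityʳ _) (does-≤?-suc t ∣ A ∣)))))
atLeast-containing (suc n) t (suc x) = begin
  sizeWhere (sizeAtLeast t) (λ A → lookup A (suc x))
    ≡⟨ ∑ₛ-suc (suc n) _ ⟩
  sizeWhere (sizeAtLeast t) (λ A → lookup A x) + ∑ₛ (suc n) (λ A → 𝟙 (does (t ≤? suc ∣ A ∣) ∧ lookup A x))
    ≡⟨ cong (sizeWhere (sizeAtLeast t) (λ A → lookup A x) +_)
            (∑ₛ-cong (suc n) (λ A → cong (λ b → 𝟙 (b ∧ lookup A x)) (does-≤?-suc t ∣ A ∣))) ⟩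
  sizeWhere (sizeAtLeast t) (λ A → lookup A x) + sizeWhere (sizeAtLeast (t ∸ 1)) (λ A → lookup A x)
    ≡⟨ cong₂ _+_ (atLeast-containing n t x) (atLeast-containing n (t ∸ 1) x) ⟩
  atLeast n (t ∸ 1) + atLeast n (t ∸ 1 ∸ 1)
    ≡⟨ sym (atLeast-suc n (t ∸ 1)) ⟩
  atLeast (suc n) (t ∸ 1) ∎
  where open ≡-Reasoning

exactly≡C : ∀ n s → exactly n s ≡ n C s
exactly≡C zero zero = refl
exactly≡C zero (suc s) = refl
exactly≡C (suc n) zero = trans (∑ₛ-suc n _) (trans (cong₂ _+_ (exactly≡C n 0) (∑ₛ-zero n)) (nC0+0 n))
  where
  nC0+0 : ∀ n → n C 0 + 0 ≡ suc n C 0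
  nC0+0 zero = refl
  nC0+0 (suc n) = refl
exactly≡C (suc n) (suc s) = begin
  exactly (suc n) (suc s)
    ≡⟨ ∑ₛ-suc n _ ⟩
  exactly n (suc s) + ∑ₛ n (λ A → 𝟙 (does (suc ∣ A ∣ ℕ.≟ suc s)))
    ≡⟨ cong (exactly n (suc s) +_) (∑ₛ-cong n (λ A → cong 𝟙 (does-⇔ (suc ∣ A ∣ ℕ.≟ suc s) (∣ A ∣ ℕ.≟ s) suc-injective (cong suc)))) ⟩
  exactly n (suc s) + exactly n s
    ≡⟨ cong₂ _+_ (exactly≡C n (suc s)) (exactly≡C n s) ⟩
  n C suc s + n C s
    ≡⟨ +-comm (n C suc s) _ ⟩
  n C s + n C suc s
    ≡⟨ nCk+nC[k+1]≡[n+1]C[k+1] n s ⟩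
  suc n C suc s ∎
  where open ≡-Reasoning

𝟙-≤?-∑< : ∀ r t a → a < t + r → 𝟙 (does (t ≤? a)) ≡ ∑< r (λ j → 𝟙 (does (a ℕ.≟ t + j)))
𝟙-≤?-∑< zero t a a<t+0 = cong 𝟙 (dec-false (t ≤? a) (<⇒≱ (subst (a <_) (+-identityʳ t) a<t+0)))
𝟙-≤?-∑< (suc r) t a a<t+r = begin
  𝟙 (does (t ≤? a))
    ≡⟨ first-or-rest ⟩
  𝟙 (does (a ℕ.≟ t + 0)) + 𝟙 (does (suc t ≤? a))
    ≡⟨ cong (_ +_) (𝟙-≤?-∑< r (suc t) a (subst (a <_) (+-suc t r) a<t+r)) ⟩
  𝟙 (does (a ℕ.≟ t + 0)) + ∑< r (λ j → 𝟙 (does (a ℕ.≟ suc t + j)))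
    ≡⟨ cong (_ +_) (∑<-cong r (λ j _ → cong (λ s → 𝟙 (does (a ℕ.≟ s))) (sym (+-suc t j)))) ⟩
  ∑< (suc r) (λ j → 𝟙 (does (a ℕ.≟ t + j))) ∎
  where
  open ≡-Reasoning
  first-or-rest : 𝟙 (does (t ≤? a)) ≡ 𝟙 (does (a ℕ.≟ t + 0)) + 𝟙 (does (suc t ≤? a))
  first-or-rest rewrite +-identityʳ t with <-cmp a t
  ... | tri< a<t _ _ rewrite dec-false (t ≤? a) (<⇒≱ a<t) | dec-false (a ℕ.≟ t) (<⇒≢ a<t)
                           | dec-false (suc t ≤? a) (<⇒≱ (m<n⇒m<1+n a<t)) = refl
  ... | tri≈ _ refl _ rewrite dec-true (a ≤? a) ≤-refl | dec-true (a ℕ.≟ a) refl | dec-false (suc a ≤? a) (n≮n a) = refl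
  ... | tri> _ _ t<a rewrite dec-true (t ≤? a) (<⇒≤ t<a) | dec-false (a ℕ.≟ t) (>⇒≢ t<a) | dec-true (suc t ≤? a) t<a = refl

atLeast≡∑C : ∀ n t r → n < t + r → atLeast n t ≡ ∑< r (λ j → n C (t + j))
atLeast≡∑C n t r n<t+r = begin
  atLeast n t
    ≡⟨ ∑ₛ-cong n (λ A → 𝟙-≤?-∑< r t ∣ A ∣ (≤-<-trans (∣p∣≤n A) n<t+r)) ⟩
  ∑ₛ n (λ A → ∑< r (λ j → 𝟙 (does (∣ A ∣ ℕ.≟ t + j))))
    ≡⟨ sumBy-∑< r _ (allSubsets n) ⟩
  ∑< r (λ j → exactly n (t + j))
    ≡⟨ ∑<-cong r (λ j _ → exactly≡C n (t + j)) ⟩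
  ∑< r (λ j → n C (t + j)) ∎
  where open ≡-Reasoning

atLeast≡binomSum : ∀ k → atLeast (2 * k) (suc k) ≡ binomSum k
atLeast≡binomSum k = trans (atLeast≡∑C (2 * k) (suc k) k (s≤s (≤-reflexive (cong (k +_) (+-identityʳ k)))))
  (cong sum (sym (map-applyUpTo (λ j → j) _ k)))

-- Rotations

[m%n+k]%n≡[m+k]%n : ∀ m k n .{{_ : NonZero n}} → (m % n + k) % n ≡ (m + k) % n
[m%n+k]%n≡[m+k]%n m k n = begin
  (m % n + k) % n          ≡⟨ %-distribˡ-+ (m % n) k n ⟩
  (m % n % n + k % n) % n  ≡⟨ cong (λ r → (r + k % n) % n) (m%n%n≡m%n m n) ⟩
  (m % n + k % n) % n      ≡⟨ sym (%-distribˡ-+ m k n) ⟩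
  (m + k) % n              ∎
  where open ≡-Reasoning

module Rotation (m : ℕ) where

  n : ℕ
  n = suc m

  rotate : ℕ → Fin n → Fin n
  rotate i a = (toℕ a + i) mod n

  toℕ-mod : ∀ v → toℕ (v mod n) ≡ v % n
  toℕ-mod v = toℕ-fromℕ< (m%n<n v n)

  toℕ-rotate : ∀ i a → toℕ (rotate i a) ≡ (toℕ a + i) % n
  toℕ-rotate i a = toℕ-mod (toℕ a + i)

  rotate-+ : ∀ i j a → rotate j (rotate i a) ≡ rotate (i + j) a
  rotate-+ i j a = toℕ-injective (begin
    toℕ (rotate j (rotate i a))  ≡⟨ toℕ-rotate j (rotate i a) ⟩
    (toℕ (rotate i a) + j) % n   ≡⟨ cong (λ r → (r + j) % n) (toℕ-rotate i a) ⟩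
    ((toℕ a + i) % n + j) % n    ≡⟨ [m%n+k]%n≡[m+k]%n (toℕ a + i) j n ⟩
    (toℕ a + i + j) % n          ≡⟨ cong (_% n) (+-assoc (toℕ a) i j) ⟩
    (toℕ a + (i + j)) % n        ≡⟨ sym (toℕ-rotate (i + j) a) ⟩
    toℕ (rotate (i + j) a)       ∎)
    where open ≡-Reasoning

  rotate-0 : ∀ a → rotate 0 a ≡ a
  rotate-0 a = toℕ-injective (trans (toℕ-rotate 0 a) (trans (cong (_% n) (+-identityʳ (toℕ a))) (m<n⇒m%n≡m (toℕ<n a))))

  rotate-n : ∀ a → rotate n a ≡ a
  rotate-n a = toℕ-injective (trans (toℕ-rotate n a) (trans ([m+n]%n≡m%n (toℕ a) n) (m<n⇒m%n≡m (toℕ<n a))))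

  rotate-inverse : ∀ i a → i ≤ n → rotate i (rotate (n ∸ i) a) ≡ a
  rotate-inverse i a i≤n = trans (rotate-+ (n ∸ i) i a) (trans (cong (λ j → rotate j a) (m∸n+n≡m i≤n)) (rotate-n a))

  rotate-mod : ∀ c v → rotate c (v mod n) ≡ (c + v) mod n
  rotate-mod c v = toℕ-injective (begin
    toℕ (rotate c (v mod n))  ≡⟨ toℕ-rotate c (v mod n) ⟩
    (toℕ (v mod n) + c) % n   ≡⟨ cong (λ r → (r + c) % n) (toℕ-mod v) ⟩
    (v % n + c) % n           ≡⟨ [m%n+k]%n≡[m+k]%n v c n ⟩
    (v + c) % n               ≡⟨ cong (_% n) (+-comm v c) ⟩
    (c + v) % n               ≡⟨ sym (toℕ-mod (c + v)) ⟩
    toℕ ((c + v) mod n)       ∎)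
    where open ≡-Reasoning

  σ≡rotate-1 : ∀ a → σ a ≡ rotate 1 a
  σ≡rotate-1 a = cong (_mod n) (+-comm 1 (toℕ a))

  σ-injective : ∀ a b → σ a ≡ σ b → a ≡ b
  σ-injective a b σa≡σb = begin
    a                      ≡⟨ sym (back a) ⟩
    rotate m (rotate 1 a)  ≡⟨ cong (rotate m) (trans (sym (σ≡rotate-1 a)) (trans σa≡σb (σ≡rotate-1 b))) ⟩
    rotate m (rotate 1 b)  ≡⟨ back b ⟩
    b                      ∎
    where
    open ≡-Reasoning
    back : ∀ c → rotate m (rotate 1 c) ≡ c
    back c = trans (rotate-+ 1 m c) (rotate-n c)

  mod-toℕ : ∀ i → toℕ i mod n ≡ i
  mod-toℕ i = toℕ-injective (trans (toℕ-mod (toℕ i)) (m<n⇒m%n≡m (toℕ<n i)))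

  ∑<-mod≡countFin : ∀ (f : Fin n → Bool) c → ∑< n (λ v → 𝟙 (f ((c + v) mod n))) ≡ countFin n f
  ∑<-mod≡countFin f c = begin
    ∑< n (λ v → h (c + v))  ≡⟨ ∑<-periodic n h (λ v → cong (𝟙 ∘ f) (toℕ-injective (trans (toℕ-mod (v + n)) (trans ([m+n]%n≡m%n v n) (sym (toℕ-mod v)))))) c ⟩
    ∑< n h                  ≡⟨ sym (countFin-∑< n f h (λ i → cong (𝟙 ∘ f) (sym (mod-toℕ i)))) ⟩
    countFin n f            ∎
    where
    open ≡-Reasoning
    h : ℕ → ℕ
    h v = 𝟙 (f (v mod n))

  countFin-rotate : ∀ (f : Fin n → Bool) c → countFin n (f ∘ rotate c) ≡ countFin n f
  countFin-rotate f c = trans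
    (countFin-∑< n (f ∘ rotate c) (λ v → 𝟙 (f ((c + v) mod n))) (λ i → cong (𝟙 ∘ f) (trans (cong (rotate c) (sym (mod-toℕ i))) (rotate-mod c (toℕ i)))))
    (∑<-mod≡countFin f c)

  lookup-σImg : ∀ (A : Subset n) a → lookup (σImg A) (σ a) ≡ lookup A a
  lookup-σImg A a = begin
    lookup (σImg A) (σ a)                                   ≡⟨ lookup∘tabulate (λ j → does (any? (λ a′ → (a′ ∈? A) ×-dec (σ a′ Data.Fin.≟ j)))) (σ a) ⟩
    does (any? (λ a′ → (a′ ∈? A) ×-dec (σ a′ Data.Fin.≟ σ a)))  ≡⟨ does-⇔ (any? (λ a′ → (a′ ∈? A) ×-dec (σ a′ Data.Fin.≟ σ a))) (a ∈? A) to from ⟩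
    does (a ∈? A)                                           ≡⟨ ∈?≡lookup a A ⟩
    lookup A a                                              ∎
    where
    open ≡-Reasoning
    to : (Σ (Fin n) λ a′ → a′ ∈ A × σ a′ ≡ σ a) → a ∈ A
    to (a′ , a′∈A , e) = subst (_∈ A) (σ-injective a′ a e) a′∈A
    from : a ∈ A → Σ (Fin n) λ a′ → a′ ∈ A × σ a′ ≡ σ a
    from a∈A = a , a∈A , refl

  lookup-σPow-rotate : ∀ (A : Subset n) i a → lookup (σPow i A) (rotate i a) ≡ lookup A a
  lookup-σPow-rotate A zero a = cong (lookup A) (rotate-0 a)
  lookup-σPow-rotate A (suc i) a = begin
    lookup (σImg (σPow i A)) (rotate (suc i) a)  ≡⟨ cong (lookup (σImg (σPow i A))) σ-rotate ⟩
    lookup (σImg (σPow i A)) (σ (rotate i a))    ≡⟨ lookup-σImg (σPow i A) (rotate i a) ⟩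
    lookup (σPow i A) (rotate i a)               ≡⟨ lookup-σPow-rotate A i a ⟩
    lookup A a                                   ∎
    where
    open ≡-Reasoning
    σ-rotate : rotate (suc i) a ≡ σ (rotate i a)
    σ-rotate = sym (trans (σ≡rotate-1 (rotate i a)) (trans (rotate-+ i 1 a) (cong (λ j → rotate j a) (+-comm i 1))))

  lookup-σPow : ∀ (A : Subset n) i x → i ≤ n → lookup (σPow i A) x ≡ lookup A (rotate (n ∸ i) x)
  lookup-σPow A i x i≤n = trans (cong (lookup (σPow i A)) (sym (rotate-inverse i x i≤n))) (lookup-σPow-rotate A i _)

  ∣σPow∣ : ∀ (A : Subset n) i → ∣ σPow i A ∣ ≡ ∣ A ∣
  ∣σPow∣ A i = begin
    ∣ σPow i A ∣                                ≡⟨ ∣p∣≡countFin (σPow i A) ⟩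
    countFin n (lookup (σPow i A))              ≡⟨ sym (countFin-rotate (lookup (σPow i A)) i) ⟩
    countFin n (lookup (σPow i A) ∘ rotate i)   ≡⟨ countFin-cong n (lookup-σPow-rotate A i) ⟩
    countFin n (lookup A)                       ≡⟨ sym (∣p∣≡countFin A) ⟩
    ∣ A ∣                                       ∎
    where open ≡-Reasoning

  countFin-σPow : ∀ (A : Subset n) x → countFin n (λ i → lookup (σPow (toℕ i) A) x) ≡ ∣ A ∣
  countFin-σPow A x = begin
    countFin n (λ i → lookup (σPow (toℕ i) A) x)
      ≡⟨ countFin-∑< n _ g (λ i → cong 𝟙 (lookup-σPow A (toℕ i) x (<⇒≤ (toℕ<n i)))) ⟩
    ∑< n g
      ≡⟨ sym (∑<-reverse n g) ⟩
    ∑< n (λ v → g (n ∸ suc v))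
      ≡⟨ ∑<-cong n (λ v v<n → cong (λ j → 𝟙 (lookup A (rotate j x))) (m∸[m∸n]≡n v<n)) ⟩
    ∑< n (λ v → 𝟙 (lookup A ((toℕ x + suc v) mod n)))
      ≡⟨ ∑<-cong n (λ v _ → cong (λ j → 𝟙 (lookup A (j mod n))) (+-suc (toℕ x) v)) ⟩
    ∑< n (λ v → 𝟙 (lookup A ((suc (toℕ x) + v) mod n)))
      ≡⟨ ∑<-mod≡countFin (lookup A) (suc (toℕ x)) ⟩
    countFin n (lookup A)
      ≡⟨ sym (∣p∣≡countFin A) ⟩
    ∣ A ∣ ∎
    where
    open ≡-Reasoning
    g : ℕ → ℕ
    g v = 𝟙 (lookup A (rotate (n ∸ v) x))

  RotationDifferences : Subset n → Set
  RotationDifferences A =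
    ∀ d → d < n → Σ (Fin n) λ y → Σ (Fin n) λ z → lookup A y ≡ true × lookup A z ≡ true × rotate d z ≡ y

  rotations-meet-≤ : ∀ (A : Subset n) → RotationDifferences A → ∀ {i j} → i ≤ j → j < n →
    Σ (Fin n) λ x → lookup (σPow i A) x ≡ true × lookup (σPow j A) x ≡ true
  rotations-meet-≤ A differences {i} {j} i≤j j<n with differences (j ∸ i) (≤-<-trans (m∸n≤m j i) j<n)
  ... | y , z , y∈A , z∈A , z+d≡y = rotate i y , trans (lookup-σPow-rotate A i y) y∈A , (begin
    lookup (σPow j A) (rotate i y)                  ≡⟨ cong (lookup (σPow j A) ∘ rotate i) (sym z+d≡y) ⟩
    lookup (σPow j A) (rotate i (rotate (j ∸ i) z)) ≡⟨ cong (lookup (σPow j A)) (rotate-+ (j ∸ i) i z) ⟩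
    lookup (σPow j A) (rotate (j ∸ i + i) z)        ≡⟨ cong (λ r → lookup (σPow j A) (rotate r z)) (m∸n+n≡m i≤j) ⟩
    lookup (σPow j A) (rotate j z)                  ≡⟨ lookup-σPow-rotate A j z ⟩
    lookup A z                                      ≡⟨ z∈A ⟩
    true                                            ∎)
    where open ≡-Reasoning

  rotations-meet : ∀ (A : Subset n) → RotationDifferences A → ∀ (i j : Fin n) →
    Σ (Fin n) λ x → lookup (σPow (toℕ i) A) x ≡ true × lookup (σPow (toℕ j) A) x ≡ true
  rotations-meet A differences i j with ≤-total (toℕ i) (toℕ j)
  ... | inj₁ i≤j = rotations-meet-≤ A differences i≤j (toℕ<n j)
  ... | inj₂ j≤i with rotations-meet-≤ A differences j≤i (toℕ<n i)
  ...   | x , x∈σʲA , x∈σⁱA = x , x∈σⁱA , x∈σʲA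

  σPow≡⇒rotation-invariant : ∀ (A : Subset n) i j → j ≤ n → σPow i A ≡ σPow j A →
    ∀ a → lookup A a ≡ lookup A (rotate (i + (n ∸ j)) a)
  σPow≡⇒rotation-invariant A i j j≤n σⁱA≡σʲA a = begin
    lookup A a                                  ≡⟨ sym (lookup-σPow-rotate A i a) ⟩
    lookup (σPow i A) (rotate i a)              ≡⟨ cong (λ B → lookup B (rotate i a)) σⁱA≡σʲA ⟩
    lookup (σPow j A) (rotate i a)              ≡⟨ lookup-σPow A j (rotate i a) j≤n ⟩
    lookup A (rotate (n ∸ j) (rotate i a))      ≡⟨ cong (lookup A) (rotate-+ i (n ∸ j) a) ⟩
    lookup A (rotate (i + (n ∸ j)) a)           ∎
    where open ≡-Reasoning

-- The set L_k

InL : ℕ → ℕ → Set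
InL k v = v ≡ 1 ⊎ v ≡ 2 ⊎ v ≡ 4 ⊎ (v % 2 ≡ 1 × 7 ≤ v × v ≤ 2 * k ∸ 1)

inL? : ∀ k v → Dec (InL k v)
inL? k v = (v ℕ.≟ 1) ⊎-dec (v ℕ.≟ 2) ⊎-dec (v ℕ.≟ 4)
             ⊎-dec ((v % 2 ℕ.≟ 1) ×-dec (7 ≤? v) ×-dec (v ≤? 2 * k ∸ 1))

2*suc : ∀ k → 2 * suc k ≡ suc (suc (2 * k))
2*suc k = *-suc 2 k

[1+2t]%2≡1 : ∀ t → suc (2 * t) % 2 ≡ 1
[1+2t]%2≡1 t = trans (cong (_% 2) (cong suc (*-comm 2 t))) ([m+kn]%n≡m%n 1 t 2)

[2t]%2≡0 : ∀ t → (2 * t) % 2 ≡ 0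
[2t]%2≡0 t = trans (cong (_% 2) (*-comm 2 t)) (m*n%n≡0 t 2)

even⊎odd : ∀ d → Σ ℕ λ t → d ≡ 2 * t ⊎ d ≡ suc (2 * t)
even⊎odd zero = 0 , inj₁ refl
even⊎odd (suc d) with even⊎odd d
... | t , inj₁ e = t , inj₂ (cong suc e)
... | t , inj₂ e = suc t , inj₁ (trans (cong suc e) (sym (2*suc t)))

¬consecutive-odd : ∀ y → suc y % 2 ≡ 1 → suc (suc y) % 2 ≡ 1 → ⊥
¬consecutive-odd y p q with even⊎odd y
... | t , inj₁ refl = 0≢1+n (trans (sym ([2t]%2≡0 (suc t))) (trans (cong (_% 2) (2*suc t)) q))
... | t , inj₂ refl = 0≢1+n (trans (sym ([2t]%2≡0 (suc t))) (trans (cong (_% 2) (2*suc t)) p))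

inL-≥2k : ∀ k v → 3 ≤ k → 2 * k ≤ v → inL k v ≡ false
inL-≥2k k v 3≤k 2k≤v = dec-false (inL? k v) ∉
  where
  6≤2k : 6 ≤ 2 * k
  6≤2k = *-monoʳ-≤ 2 3≤k
  ∉ : ¬ InL k v
  ∉ (inj₁ refl) with s≤s () ← ≤-trans 6≤2k 2k≤v
  ∉ (inj₂ (inj₁ refl)) with s≤s (s≤s ()) ← ≤-trans 6≤2k 2k≤v
  ∉ (inj₂ (inj₂ (inj₁ refl))) with s≤s (s≤s (s≤s (s≤s ()))) ← ≤-trans 6≤2k 2k≤v
  ∉ (inj₂ (inj₂ (inj₂ (_ , _ , v≤2k∸1)))) =
    <⇒≱ (≤-<-trans v≤2k∸1 (∸-monoʳ-< {2 * k} (s≤s z≤n) (≤-trans (s≤s z≤n) 6≤2k))) 2k≤v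

inL-odd : ∀ k t → 3 ≤ t → t < k → inL k (suc (2 * t)) ≡ true
inL-odd (suc k) t 3≤t (s≤s t≤k) = dec-true (inL? (suc k) (suc (2 * t)))
  (inj₂ (inj₂ (inj₂ ([1+2t]%2≡1 t , s≤s (*-monoʳ-≤ 2 3≤t) ,
    subst (suc (2 * t) ≤_) (sym (cong (_∸ 1) (2*suc k))) (s≤s (*-monoʳ-≤ 2 t≤k))))))

inL-suc : ∀ k v → v ≤ 2 * k → inL (suc k) v ≡ inL k v
inL-suc k v v≤2k = does-⇔ (inL? (suc k) v) (inL? k v) to from
  where
  to : InL (suc k) v → InL k v
  to (inj₁ x) = inj₁ x
  to (inj₂ (inj₁ x)) = inj₂ (inj₁ x)
  to (inj₂ (inj₂ (inj₁ x))) = inj₂ (inj₂ (inj₁ x))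
  to (inj₂ (inj₂ (inj₂ (odd , 7≤v , _)))) with m≤n⇒m<n∨m≡n v≤2k
  ... | inj₁ v<2k = inj₂ (inj₂ (inj₂ (odd , 7≤v , ∸-monoˡ-≤ 1 v<2k)))
  ... | inj₂ refl = ⊥-elim (0≢1+n (trans (sym ([2t]%2≡0 k)) odd))
  from : InL k v → InL (suc k) v
  from (inj₁ x) = inj₁ x
  from (inj₂ (inj₁ x)) = inj₂ (inj₁ x)
  from (inj₂ (inj₂ (inj₁ x))) = inj₂ (inj₂ (inj₁ x))
  from (inj₂ (inj₂ (inj₂ (odd , 7≤v , v≤2k∸1)))) =
    inj₂ (inj₂ (inj₂ (odd , 7≤v , ≤-trans v≤2k∸1 (∸-monoˡ-≤ 1 (*-monoʳ-≤ 2 (n≤1+n k))))))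

inL-consecutive : ∀ k y → inL k (suc y) ≡ true → inL k (suc (suc y)) ≡ true → y ≡ 0
inL-consecutive k y p q = go (does≡true⇒ (inL? k _) p) (does≡true⇒ (inL? k _) q)
  where
  below7 : ∀ {a b} → a ≡ b → b < 7 → 7 ≤ a → y ≡ 0
  below7 refl b<7 7≤b = ⊥-elim (<⇒≱ b<7 7≤b)
  go : InL k (suc y) → InL k (suc (suc y)) → y ≡ 0
  go (inj₁ refl) _ = refl
  go (inj₂ (inj₁ refl)) (inj₁ ())
  go (inj₂ (inj₁ refl)) (inj₂ (inj₁ ()))
  go (inj₂ (inj₁ refl)) (inj₂ (inj₂ (inj₁ ())))
  go (inj₂ (inj₁ refl)) (inj₂ (inj₂ (inj₂ (_ , s≤s (s≤s (s≤s ())) , _))))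
  go (inj₂ (inj₂ (inj₁ refl))) (inj₁ ())
  go (inj₂ (inj₂ (inj₁ refl))) (inj₂ (inj₁ ()))
  go (inj₂ (inj₂ (inj₁ refl))) (inj₂ (inj₂ (inj₁ ())))
  go (inj₂ (inj₂ (inj₁ refl))) (inj₂ (inj₂ (inj₂ (_ , s≤s (s≤s (s≤s (s≤s (s≤s ())))) , _))))
  go (inj₂ (inj₂ (inj₂ (_ , 7≤v , _)))) (inj₁ e) = below7 (suc-injective e) (s≤s z≤n) 7≤v
  go (inj₂ (inj₂ (inj₂ (_ , 7≤v , _)))) (inj₂ (inj₁ e)) = below7 (suc-injective e) (s≤s (s≤s z≤n)) 7≤v
  go (inj₂ (inj₂ (inj₂ (_ , 7≤v , _)))) (inj₂ (inj₂ (inj₁ e))) = below7 (suc-injective e) (s≤s (s≤s (s≤s (s≤s z≤n)))) 7≤v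
  go (inj₂ (inj₂ (inj₂ (p , _ , _)))) (inj₂ (inj₂ (inj₂ (q , _ , _)))) = ⊥-elim (¬consecutive-odd y p q)

∑<-inL : ∀ k → 3 ≤ k → ∑< (suc (2 * k)) (λ v → 𝟙 (inL k (suc v))) ≡ k
∑<-inL k 3≤k with m≤n⇒∃[o]m+o≡n 3≤k
... | j , refl = go j
  where
  𝟙≡0 : ∀ {b} → b ≡ false → 𝟙 b ≡ 0
  𝟙≡0 refl = refl
  go : ∀ j → ∑< (suc (2 * (3 + j))) (λ v → 𝟙 (inL (3 + j) (suc v))) ≡ 3 + j
  go zero = refl
  go (suc j) = begin
    ∑< (suc (2 * suc k′)) g′
      ≡⟨ cong (λ r → ∑< (suc r) g′) (2*suc k′) ⟩
    ∑< (3 + 2 * k′) g′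
      ≡⟨ trans (∑<-suc (2 + 2 * k′) g′) (cong (_+ g′ (2 + 2 * k′)) (trans (∑<-suc (suc (2 * k′)) g′) (cong (_+ g′ (suc (2 * k′))) (∑<-suc (2 * k′) g′)))) ⟩
    ∑< (2 * k′) g′ + g′ (2 * k′) + g′ (suc (2 * k′)) + g′ (2 + 2 * k′)
      ≡⟨ cong₂ _+_ (cong₂ _+_ (cong₂ _+_ below top) (𝟙≡0 (inL-≥2k (suc k′) _ 3≤k′+1 (≤-reflexive (2*suc k′)))))
                   (𝟙≡0 (inL-≥2k (suc k′) _ 3≤k′+1 (≤-trans (≤-reflexive (2*suc k′)) (n≤1+n _)))) ⟩
    k′ + 1 + 0 + 0
      ≡⟨ trans (+-identityʳ _) (trans (+-identityʳ _) (+-comm k′ 1)) ⟩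
    suc k′ ∎
    where
    open ≡-Reasoning
    k′ = 3 + j
    3≤k′+1 : 3 ≤ suc k′
    3≤k′+1 = s≤s (s≤s (s≤s z≤n))
    g g′ : ℕ → ℕ
    g v = 𝟙 (inL k′ (suc v))
    g′ v = 𝟙 (inL (suc k′) (suc v))
    top : g′ (2 * k′) ≡ 1
    top = cong 𝟙 (inL-odd (suc k′) k′ (s≤s (s≤s (s≤s z≤n))) ≤-refl)
    below : ∑< (2 * k′) g′ ≡ k′
    below = begin
      ∑< (2 * k′) g′          ≡⟨ ∑<-cong (2 * k′) (λ v v<2k′ → cong 𝟙 (inL-suc k′ (suc v) v<2k′)) ⟩
      ∑< (2 * k′) g           ≡⟨ sym (+-identityʳ _) ⟩
      ∑< (2 * k′) g + 0       ≡⟨ cong (∑< (2 * k′) g +_) (sym (𝟙≡0 (inL-≥2k k′ (suc (2 * k′)) (s≤s (s≤s (s≤s z≤n))) (n≤1+n _)))) ⟩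
      ∑< (2 * k′) g + g (2 * k′) ≡⟨ sym (∑<-suc (2 * k′) g) ⟩
      ∑< (suc (2 * k′)) g     ≡⟨ go j ⟩
      k′                      ∎

module Differences (k : ℕ) (3≤k : 3 ≤ k) where

  n : ℕ
  n = suc (2 * k)

  -- d ≡ y - z (mod n) for two 0-based elements y, z of L_k
  IsDifference : ℕ → Set
  IsDifference d = Σ ℕ λ y → Σ ℕ λ z →
    y < n × z < n × inL k (suc y) ≡ true × inL k (suc z) ≡ true × (z + d) % n ≡ y

  IsPlainDifference : ℕ → Set
  IsPlainDifference e = Σ ℕ λ y → Σ ℕ λ z →
    y < n × inL k (suc y) ≡ true × inL k (suc z) ≡ true × y ≡ z + e

  difference : ∀ {e} → IsPlainDifference e → IsDifference e
  difference {e} (y , z , y<n , y∈L , z∈L , y≡z+e) =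
    y , z , y<n , ≤-<-trans (subst (z ≤_) (sym y≡z+e) (m≤m+n z e)) y<n , y∈L , z∈L ,
    trans (cong (_% n) (sym y≡z+e)) (m<n⇒m%n≡m y<n)

  negated-difference : ∀ {e d} → IsPlainDifference e → e + d ≡ n → IsDifference d
  negated-difference {e} {d} (y , z , y<n , y∈L , z∈L , y≡z+e) e+d≡n =
    z , y , z<n , y<n , z∈L , y∈L , (begin
      (y + d) % n        ≡⟨ cong (λ w → (w + d) % n) y≡z+e ⟩
      (z + e + d) % n    ≡⟨ cong (_% n) (trans (+-assoc z e d) (cong (z +_) e+d≡n)) ⟩
      (z + n) % n        ≡⟨ [m+n]%n≡m%n z n ⟩
      z % n              ≡⟨ m<n⇒m%n≡m z<n ⟩
      z                  ∎)
    where
    open ≡-Reasoning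
    z<n : z < n
    z<n = ≤-<-trans (subst (z ≤_) (sym y≡z+e) (m≤m+n z e)) y<n

  3≤2k : 3 ≤ 2 * k
  3≤2k = ≤-trans 3≤k (m≤m+n k (k + 0))

  -- 0-based, L_k = {0, 1, 3} ∪ {6, 8, …, 2k-2}
  diff-0 : IsPlainDifference 0
  diff-0 = 0 , 0 , s≤s z≤n , refl , refl , refl
  diff-1 : IsPlainDifference 1
  diff-1 = 1 , 0 , s≤s (≤-trans (s≤s z≤n) 3≤2k) , refl , refl , refl
  diff-2 : IsPlainDifference 2
  diff-2 = 3 , 1 , s≤s 3≤2k , refl , refl , refl
  diff-3 : IsPlainDifference 3
  diff-3 = 3 , 0 , s≤s 3≤2k , refl , refl , refl

  diff-even : ∀ t → 3 ≤ t → t < k → IsPlainDifference (2 * t)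
  diff-even t 3≤t t<k = 2 * t , 0 , s≤s (*-monoʳ-≤ 2 (<⇒≤ t<k)) , inL-odd k t 3≤t t<k , refl , refl

  diff-odd : ∀ t → 2 ≤ t → suc t < k → IsPlainDifference (suc (2 * t))
  diff-odd t 2≤t 1+t<k = 2 * suc t , 1 , s≤s (*-monoʳ-≤ 2 (<⇒≤ 1+t<k)) , inL-odd k (suc t) (s≤s 2≤t) 1+t<k , refl , 2*suc t

  -- 4 ≡ 1 - (2k-2) for k > 3, and 4 ≡ 0 - 3 for k = 3
  difference-4 : IsDifference 4
  difference-4 with m≤n⇒m<n∨m≡n 3≤k
  ... | inj₂ refl = negated-difference diff-3 refl
  ... | inj₁ 3<k = negated-difference (diff-odd (k ∸ 2) (∸-monoˡ-≤ 2 3<k) (≤-reflexive [k∸2]+2≡k)) [2k-3]+4≡n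
    where
    [k∸2]+2≡k : suc (suc (k ∸ 2)) ≡ k
    [k∸2]+2≡k = m+[n∸m]≡n (≤-trans (s≤s (s≤s z≤n)) 3≤k)
    [2k-3]+4≡n : suc (2 * (k ∸ 2)) + 4 ≡ n
    [2k-3]+4≡n = trans (+-comm (suc (2 * (k ∸ 2))) 4) (cong suc (sym (begin
      2 * k                          ≡⟨ cong (2 *_) (sym [k∸2]+2≡k) ⟩
      2 * suc (suc (k ∸ 2))          ≡⟨ trans (2*suc (suc (k ∸ 2))) (cong (λ w → suc (suc w)) (2*suc (k ∸ 2))) ⟩
      suc (suc (suc (suc (2 * (k ∸ 2))))) ∎)))
      where open ≡-Reasoning

  every-residue-is-difference : ∀ d → d < n → IsDifference d
  every-residue-is-difference d d<n with even⊎odd d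
  ... | t , inj₁ refl = even t d<n
    where
    even : ∀ t → 2 * t < n → IsDifference (2 * t)
    even zero _ = difference diff-0
    even (suc zero) _ = difference diff-2
    even (suc (suc zero)) _ = difference-4
    even t@(suc (suc (suc _))) 2t<n with m≤n⇒m<n∨m≡n (*-cancelˡ-≤ 2 (s≤s⁻¹ 2t<n))
    ... | inj₁ t<k = difference (diff-even t (s≤s (s≤s (s≤s z≤n))) t<k)
    ... | inj₂ refl = negated-difference diff-1 refl
  ... | t , inj₂ refl = odd t d<n
    where
    odd : ∀ t → suc (2 * t) < n → IsDifference (suc (2 * t))
    odd zero _ = difference diff-1
    odd (suc zero) _ = difference diff-3
    odd t@(suc (suc _)) 2t+1<n with m≤n⇒m<n∨m≡n (*-cancelˡ-< 2 t k (s≤s⁻¹ 2t+1<n))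
    ... | inj₁ 1+t<k = difference (diff-odd t (s≤s (s≤s z≤n)) 1+t<k)
    ... | inj₂ refl = negated-difference diff-2 (cong suc (sym (2*suc t)))

-- The family P_k

-- For F ∩ Q = ∅ and F̄ ⊆ Q, the families F ∪ (Q ∖ F̄) and F̄ together count like F and Q together.
𝟙-∪-∖ : ∀ f q f̄ b → (f ≡ true → q ≡ false) → (f̄ ≡ true → q ≡ true) →
  𝟙 ((f ∨ (q ∧ not f̄)) ∧ b) + 𝟙 (f̄ ∧ b) ≡ 𝟙 (f ∧ b) + 𝟙 (q ∧ b)
𝟙-∪-∖ f q f̄ false _ _ rewrite ∧-zeroʳ (f ∨ (q ∧ not f̄)) | ∧-zeroʳ f̄ | ∧-zeroʳ f | ∧-zeroʳ q = refl
𝟙-∪-∖ true q true true f⇒¬q f̄⇒q with () ← trans (sym (f⇒¬q refl)) (f̄⇒q refl)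
𝟙-∪-∖ true q false true f⇒¬q _ rewrite f⇒¬q refl = refl
𝟙-∪-∖ false true true true _ _ = refl
𝟙-∪-∖ false true false true _ _ = refl
𝟙-∪-∖ false false true true _ f̄⇒q with () ← f̄⇒q refl
𝟙-∪-∖ false false false true _ _ = refl

module Construction (k : ℕ) (3≤k : 3 ≤ k) where

  open Rotation (2 * k)
  open Differences k 3≤k using (every-residue-is-difference)

  shift : Fin n → Subset n
  shift i = σPow (toℕ i) (L k)

  lookup-L : ∀ v → v < n → lookup (L k) (v mod n) ≡ inL k (suc v)
  lookup-L v v<n = trans (lookup∘tabulate (λ j → inL k (suc (toℕ j))) (v mod n))
    (cong (λ w → inL k (suc w)) (trans (toℕ-mod v) (m<n⇒m%n≡m v<n)))

  ∣L∣ : ∣ L k ∣ ≡ k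
  ∣L∣ = begin
    ∣ L k ∣                               ≡⟨ ∣p∣≡countFin (L k) ⟩
    countFin n (lookup (L k))             ≡⟨ countFin-∑< n (lookup (L k)) (λ v → 𝟙 (inL k (suc v)))
                                               (λ i → cong 𝟙 (lookup∘tabulate (λ j → inL k (suc (toℕ j))) i)) ⟩
    ∑< n (λ v → 𝟙 (inL k (suc v)))        ≡⟨ ∑<-inL k 3≤k ⟩
    k                                     ∎
    where open ≡-Reasoning

  ∣shift∣ : ∀ i → ∣ shift i ∣ ≡ k
  ∣shift∣ i = trans (∣σPow∣ (L k) (toℕ i)) ∣L∣

  ∣∁shift∣ : ∀ i → ∣ ∁ (shift i) ∣ ≡ suc k
  ∣∁shift∣ i = begin
    ∣ ∁ (shift i) ∣        ≡⟨ ∣∁p∣≡n∸∣p∣ (shift i) ⟩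
    n ∸ ∣ shift i ∣        ≡⟨ cong (n ∸_) (∣shift∣ i) ⟩
    suc (k + (k + 0)) ∸ k  ≡⟨ cong (λ w → suc (k + w) ∸ k) (+-identityʳ k) ⟩
    suc k + k ∸ k          ≡⟨ m+n∸n≡m (suc k) k ⟩
    suc k                  ∎
    where open ≡-Reasoning

  L-differences : RotationDifferences (L k)
  L-differences d d<n with every-residue-is-difference d d<n
  ... | y , z , y<n , z<n , y∈L , z∈L , z+d≡y =
    y mod n , z mod n , trans (lookup-L y y<n) y∈L , trans (lookup-L z z<n) z∈L , toℕ-injective (begin
      toℕ (rotate d (z mod n))  ≡⟨ cong toℕ (rotate-mod d z) ⟩
      toℕ ((d + z) mod n)       ≡⟨ toℕ-mod (d + z) ⟩
      (d + z) % n               ≡⟨ cong (_% n) (+-comm d z) ⟩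
      (z + d) % n               ≡⟨ z+d≡y ⟩
      y                         ≡⟨ sym (trans (toℕ-mod y) (m<n⇒m%n≡m y<n)) ⟩
      toℕ (y mod n)             ∎)
    where open ≡-Reasoning

  -- 0 and 1 lie in L_k, so D and D+1 would too; but 0, 1 is the only consecutive pair,
  -- and n - 1 ∉ L_k rules out D + 1 = n.
  L-not-rotation-invariant : ∀ D → 0 < D → D < n → ¬ (∀ a → lookup (L k) a ≡ lookup (L k) (rotate D a))
  L-not-rotation-invariant D 0<D D<n invariant = impossible (m≤n⇒m<n∨m≡n D<n)
    where
    moved-by-D : ∀ v → v < n → inL k (suc v) ≡ true → lookup (L k) ((D + v) mod n) ≡ true
    moved-by-D v v<n v∈L = begin
      lookup (L k) ((D + v) mod n)        ≡⟨ cong (lookup (L k)) (sym (rotate-mod D v)) ⟩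
      lookup (L k) (rotate D (v mod n))   ≡⟨ sym (invariant (v mod n)) ⟩
      lookup (L k) (v mod n)              ≡⟨ lookup-L v v<n ⟩
      inL k (suc v)                       ≡⟨ v∈L ⟩
      true                                ∎
      where open ≡-Reasoning
    D∈L : inL k (suc D) ≡ true
    D∈L = trans (sym (lookup-L D D<n))
      (subst (λ w → lookup (L k) (w mod n) ≡ true) (+-identityʳ D) (moved-by-D 0 (s≤s z≤n) refl))
    impossible : suc D < n ⊎ suc D ≡ n → ⊥
    impossible (inj₁ 1+D<n) = <⇒≢ 0<D (sym (inL-consecutive k D D∈L 2+D∈L))
      where
      1<n : 1 < n
      1<n = s≤s (≤-trans (s≤s z≤n) (≤-trans 3≤k (m≤m+n k _)))
      2+D∈L : inL k (suc (suc D)) ≡ true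
      2+D∈L = trans (sym (lookup-L (suc D) 1+D<n))
        (subst (λ w → lookup (L k) (w mod n) ≡ true) (+-comm D 1) (moved-by-D 1 1<n refl))
    impossible (inj₂ 1+D≡n) with () ← trans (sym D∈L) (inL-≥2k k (suc D) 3≤k (subst (2 * k ≤_) (sym 1+D≡n) (n≤1+n _)))

  distinct-shifts : ∀ {i j} → i < j → j < n → σPow i (L k) ≢ σPow j (L k)
  distinct-shifts {i} {j} i<j j<n e = L-not-rotation-invariant (i + (n ∸ j))
    (≤-trans (m<n⇒0<n∸m j<n) (m≤n+m (n ∸ j) i))
    (subst (i + (n ∸ j) <_) (m+[n∸m]≡n (<⇒≤ j<n)) (+-monoˡ-< (n ∸ j) i<j))
    (σPow≡⇒rotation-invariant (L k) i j (<⇒≤ j<n) e)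

  shift-injective : ∀ i j → shift i ≡ shift j → i ≡ j
  shift-injective i j e with <-cmp (toℕ i) (toℕ j)
  ... | tri< i<j _ _ = ⊥-elim (distinct-shifts i<j (toℕ<n j) e)
  ... | tri≈ _ i≡j _ = toℕ-injective i≡j
  ... | tri> _ _ j<i = ⊥-elim (distinct-shifts j<i (toℕ<n i) (sym e))

  ∁shift : Fin n → Subset n
  ∁shift = ∁ ∘ shift

  ∁shift-injective : ∀ i j → ∁shift i ≡ ∁shift j → i ≡ j
  ∁shift-injective i j e = shift-injective i j (∁-injective e)

  𝓕⇒shift : ∀ A → 𝓕 k A ≡ true → Σ (Fin n) λ i → A ≡ shift i
  𝓕⇒shift A = does≡true⇒ (any? (λ i → A ≟ₛ shift i))

  𝓕̄⇒∁shift : ∀ A → 𝓕̄ k A ≡ true → Σ (Fin n) λ i → A ≡ ∁shift i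
  𝓕̄⇒∁shift A = does≡true⇒ (any? (λ i → A ≟ₛ ∁shift i))

  𝓕⇒¬𝓠 : ∀ A → 𝓕 k A ≡ true → 𝓠 k A ≡ false
  𝓕⇒¬𝓠 A A∈𝓕 with 𝓕⇒shift A A∈𝓕
  ... | i , refl = dec-false (suc k ≤? ∣ shift i ∣) (λ k<∣A∣ → n≮n k (subst (suc k ≤_) (∣shift∣ i) k<∣A∣))

  𝓕̄⇒𝓠 : ∀ A → 𝓕̄ k A ≡ true → 𝓠 k A ≡ true
  𝓕̄⇒𝓠 A A∈𝓕̄ with 𝓕̄⇒∁shift A A∈𝓕̄
  ... | i , refl = dec-true (suc k ≤? ∣ ∁shift i ∣) (≤-reflexive (sym (∣∁shift∣ i)))

  sizeWhere-𝓟+𝓕̄ : ∀ m → sizeWhere (𝓟 k) m + sizeWhere (𝓕̄ k) m ≡ sizeWhere (𝓕 k) m + sizeWhere (𝓠 k) m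
  sizeWhere-𝓟+𝓕̄ m = trans (sym (∑ₛ-+ n _ _)) (trans
    (∑ₛ-cong n (λ A → 𝟙-∪-∖ (𝓕 k A) (𝓠 k A) (𝓕̄ k A) (m A) (𝓕⇒¬𝓠 A) (𝓕̄⇒𝓠 A)))
    (∑ₛ-+ n _ _))

  degree-𝓕 : ∀ x → degree (𝓕 k) x ≡ k
  degree-𝓕 x = begin
    degree (𝓕 k) x                              ≡⟨ degree≡sizeWhere (𝓕 k) x ⟩
    sizeWhere (𝓕 k) (λ A → lookup A x)          ≡⟨ sizeWhere-enumerated n shift shift-injective (λ A → lookup A x) ⟩
    countFin n (λ i → lookup (shift i) x)       ≡⟨ countFin-σPow (L k) x ⟩
    ∣ L k ∣                                     ≡⟨ ∣L∣ ⟩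
    k                                           ∎
    where open ≡-Reasoning

  degree-𝓕̄ : ∀ x → degree (𝓕̄ k) x ≡ suc k
  degree-𝓕̄ x = +-cancelʳ-≡ k _ _ (begin
    degree (𝓕̄ k) x + k
      ≡⟨ cong₂ _+_ (trans (degree≡sizeWhere (𝓕̄ k) x) (sizeWhere-enumerated n ∁shift ∁shift-injective (λ A → lookup A x)))
                   (sym (trans (countFin-σPow (L k) x) ∣L∣)) ⟩
    countFin n (λ i → lookup (∁shift i) x) + countFin n (λ i → lookup (shift i) x)
      ≡⟨ cong (_+ countFin n (λ i → lookup (shift i) x)) (countFin-cong n (λ i → lookup-map x not (shift i))) ⟩
    countFin n (λ i → not (lookup (shift i) x)) + countFin n (λ i → lookup (shift i) x)
      ≡⟨ countFin-not n (λ i → lookup (shift i) x) ⟩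
    suc (k + (k + 0))
      ≡⟨ cong suc (trans (cong (k +_) (+-identityʳ k)) (+-comm k k)) ⟩
    suc k + k ∎)
    where open ≡-Reasoning

  degree-𝓠 : ∀ x → degree (𝓠 k) x ≡ atLeast (2 * k) k
  degree-𝓠 x = trans (degree≡sizeWhere (𝓠 k) x) (atLeast-containing (2 * k) (suc k) x)

  size-𝓟 : size (𝓟 k) ≡ size (𝓠 k)
  size-𝓟 = +-cancelʳ-≡ n _ _ (begin
    size (𝓟 k) + n                                        ≡⟨ cong₂ _+_ (size≡sizeWhere (𝓟 k)) (sym (size-enumerated n ∁shift ∁shift-injective)) ⟩
    sizeWhere (𝓟 k) (λ _ → true) + size (𝓕̄ k)            ≡⟨ cong (sizeWhere (𝓟 k) (λ _ → true) +_) (size≡sizeWhere (𝓕̄ k)) ⟩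
    sizeWhere (𝓟 k) (λ _ → true) + sizeWhere (𝓕̄ k) (λ _ → true) ≡⟨ sizeWhere-𝓟+𝓕̄ (λ _ → true) ⟩
    sizeWhere (𝓕 k) (λ _ → true) + sizeWhere (𝓠 k) (λ _ → true) ≡⟨ cong₂ _+_ (sym (size≡sizeWhere (𝓕 k))) (sym (size≡sizeWhere (𝓠 k))) ⟩
    size (𝓕 k) + size (𝓠 k)                               ≡⟨ cong (_+ size (𝓠 k)) (size-enumerated n shift shift-injective) ⟩
    n + size (𝓠 k)                                        ≡⟨ +-comm n _ ⟩
    size (𝓠 k) + n                                        ∎)
    where open ≡-Reasoning

  1+degree-𝓟 : ∀ x → suc (degree (𝓟 k) x) ≡ atLeast (2 * k) k
  1+degree-𝓟 x = +-cancelʳ-≡ k _ _ (begin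
    suc (degree (𝓟 k) x) + k                 ≡⟨ sym (+-suc (degree (𝓟 k) x) k) ⟩
    degree (𝓟 k) x + suc k                   ≡⟨ cong₂ _+_ (degree≡sizeWhere (𝓟 k) x) (trans (sym (degree-𝓕̄ x)) (degree≡sizeWhere (𝓕̄ k) x)) ⟩
    sizeWhere (𝓟 k) (λ A → lookup A x) + sizeWhere (𝓕̄ k) (λ A → lookup A x) ≡⟨ sizeWhere-𝓟+𝓕̄ (λ A → lookup A x) ⟩
    sizeWhere (𝓕 k) (λ A → lookup A x) + sizeWhere (𝓠 k) (λ A → lookup A x) ≡⟨ cong₂ _+_ (trans (sym (degree≡sizeWhere (𝓕 k) x)) (degree-𝓕 x)) (trans (sym (degree≡sizeWhere (𝓠 k) x)) (degree-𝓠 x)) ⟩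
    k + atLeast (2 * k) k                    ≡⟨ +-comm k _ ⟩
    atLeast (2 * k) k + k                    ∎)
    where open ≡-Reasoning

  𝓟-regular : Regular (𝓟 k)
  𝓟-regular x y = suc-injective (trans (1+degree-𝓟 x) (sym (1+degree-𝓟 y)))

  size-𝓠 : size (𝓠 k) ≡ atLeast (2 * k) (suc k) + atLeast (2 * k) k
  size-𝓠 = trans (length-filterᵇ (𝓠 k) (allSubsets n)) (atLeast-suc (2 * k) (suc k))

  diversity-𝓠 : diversity (𝓠 k) ≡ atLeast (2 * k) (suc k)
  diversity-𝓠 = begin
    diversity (𝓠 k)                                              ≡⟨ diversity-regular (𝓠 k) _ degree-𝓠 ⟩
    size (𝓠 k) ∸ atLeast (2 * k) k                               ≡⟨ cong (_∸ atLeast (2 * k) k) size-𝓠 ⟩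
    atLeast (2 * k) (suc k) + atLeast (2 * k) k ∸ atLeast (2 * k) k ≡⟨ m+n∸n≡m (atLeast (2 * k) (suc k)) (atLeast (2 * k) k) ⟩
    atLeast (2 * k) (suc k)                                      ∎
    where open ≡-Reasoning

  diversity-𝓟 : diversity (𝓟 k) ≡ diversity (𝓠 k) + 1
  diversity-𝓟 = begin
    diversity (𝓟 k)                                  ≡⟨ diversity-regular (𝓟 k) d (λ x → 𝓟-regular x zero) ⟩
    size (𝓟 k) ∸ d                                   ≡⟨ cong (_∸ d) (trans size-𝓟 size-𝓠) ⟩
    atLeast (2 * k) (suc k) + atLeast (2 * k) k ∸ d  ≡⟨ cong (λ c → atLeast (2 * k) (suc k) + c ∸ d) (sym (1+degree-𝓟 zero)) ⟩
    atLeast (2 * k) (suc k) + suc d ∸ d              ≡⟨ cong (_∸ d) (sym (+-assoc (atLeast (2 * k) (suc k)) 1 d)) ⟩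
    atLeast (2 * k) (suc k) + 1 + d ∸ d              ≡⟨ m+n∸n≡m _ d ⟩
    atLeast (2 * k) (suc k) + 1                      ≡⟨ cong (_+ 1) (sym diversity-𝓠) ⟩
    diversity (𝓠 k) + 1                              ∎
    where
    open ≡-Reasoning
    d : ℕ
    d = degree (𝓟 k) zero

  MemberOf𝓟 : Subset n → Set
  MemberOf𝓟 A = (Σ (Fin n) λ i → A ≡ shift i) ⊎ (suc k ≤ ∣ A ∣ × 𝓕̄ k A ≡ false)

  member-of-𝓟 : ∀ A → T (𝓟 k A) → MemberOf𝓟 A
  member-of-𝓟 A A∈𝓟 with Equivalence.to T-∨ A∈𝓟
  ... | inj₁ A∈𝓕 = inj₁ (𝓕⇒shift A (Equivalence.to T-≡ A∈𝓕))
  ... | inj₂ A∈𝓠∖𝓕̄ with Equivalence.to (T-∧ {𝓠 k A}) A∈𝓠∖𝓕̄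
  ...   | A∈𝓠 , A∉𝓕̄ = inj₂ (does≡true⇒ (suc k ≤? ∣ A ∣) (Equivalence.to T-≡ A∈𝓠) , Equivalence.to T-not-≡ A∉𝓕̄)

  shift-meets-large : ∀ i {B} → suc k ≤ ∣ B ∣ → 𝓕̄ k B ≡ false → ¬ Disjoint (shift i) B
  shift-meets-large i {B} k<∣B∣ B∉𝓕̄ disjoint =
    not-¬ refl (trans (sym B∉𝓕̄) (dec-true (any? (λ j → B ≟ₛ ∁shift j)) (i , B≡∁A)))
    where
    B≡∁A : B ≡ ∁shift i
    B≡∁A = ⊆∧∣q∣≤∣p∣⇒p≡q B (∁shift i) (disjoint⇒⊆∁ disjoint) (subst (_≤ ∣ B ∣) (sym (∣∁shift∣ i)) k<∣B∣)

  members-meet : ∀ {A B} → MemberOf𝓟 A → MemberOf𝓟 B → ¬ Disjoint A B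
  members-meet (inj₁ (i , refl)) (inj₁ (j , refl)) disjoint with rotations-meet (L k) L-differences i j
  ... | x , x∈A , x∈B = disjoint (lookup⇒[]= x (shift i) x∈A) (lookup⇒[]= x (shift j) x∈B)
  members-meet (inj₁ (i , refl)) (inj₂ (k<∣B∣ , B∉𝓕̄)) disjoint = shift-meets-large i k<∣B∣ B∉𝓕̄ disjoint
  members-meet (inj₂ (k<∣A∣ , A∉𝓕̄)) (inj₁ (j , refl)) disjoint =
    shift-meets-large j k<∣A∣ A∉𝓕̄ (λ x∈B x∈A → disjoint x∈A x∈B)
  members-meet {A} {B} (inj₂ (k<∣A∣ , _)) (inj₂ (k<∣B∣ , _)) disjoint = <⇒≱ n<∣B∣+∣A∣ ∣B∣+∣A∣≤n
    where
    ∣B∣+∣A∣≤n : ∣ B ∣ + ∣ A ∣ ≤ n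
    ∣B∣+∣A∣≤n = m≤o∸n⇒m+n≤o ∣ B ∣ (∣p∣≤n A) (subst (∣ B ∣ ≤_) (∣∁p∣≡n∸∣p∣ A) (p⊆q⇒∣p∣≤∣q∣ (disjoint⇒⊆∁ disjoint)))
    n<∣B∣+∣A∣ : n < ∣ B ∣ + ∣ A ∣
    n<∣B∣+∣A∣ = ≤-trans (≤-reflexive (cong suc (trans (cong (λ w → suc (k + w)) (+-identityʳ k)) (sym (+-suc k k)))))
      (+-mono-≤ k<∣B∣ k<∣A∣)

  𝓟-intersecting : Intersecting (𝓟 k)
  𝓟-intersecting A B A∈𝓟 B∈𝓟 with nonempty? (A ∩ B)
  ... | yes A∩B≢∅ = A∩B≢∅
  ... | no A∩B≡∅ = ⊥-elim (members-meet (member-of-𝓟 A A∈𝓟) (member-of-𝓟 B B∈𝓟)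
                                         (λ x∈A x∈B → A∩B≡∅ (_ , x∈p∩q⁺ (x∈A , x∈B))))

theorem2p1 : (k : ℕ) → 3 ≤ k →
    Regular (𝓟 k) × Intersecting (𝓟 k)
      × diversity (𝓟 k) ≡ diversity (𝓠 k) + 1
      × diversity (𝓠 k) ≡ binomSum k
theorem2p1 k 3≤k = 𝓟-regular , 𝓟-intersecting , diversity-𝓟 , trans diversity-𝓠 (atLeast≡binomSum k)
  where open Construction k 3≤k
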